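{- Let $G$ be a finite simple graph, $k$ a positive integer, $G^k$ the disjoint union of $k$ copies of $G$, and let $n\ge k|V(G)|$. Then $\bar r(G^k)=k\,\bar r(G)$, where $\bar r$ is computed with respect to $K_n$.
   Context: $K_n$ is the complete graph on $[n]$ without loops; a homomorphism $f:G\to K_n$ is a map $V(G)\to[n]$ sending adjacent vertices to distinct vertices. An edge $xy$ of $K_n$ is $f$-odd if the number of edges $uv\in E(G)$ with $\{f(u),f(v)\}=\{x,y\}$ is odd; a vertex of $K_n$ is $f$-odd if incident with an $f$-odd edge; $V_{\mathrm{odd}}(f)$ is the set of $f$-odd vertices. Define $r(f)=|V(G)|-|f(V(G))|+\frac12|V_{\mathrm{odd}}(f)|$ and $\bar r(G)=\min\{r(f): f:G\to K_n \text{ a homomorphism}\}$. -}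

module Defs where

open import Data.Nat using (ℕ; zero; suc; _+_; _*_; _<ᵇ_; _≤_)
open import Data.Nat.Properties using ()
open import Data.Bool using (Bool; true; false; _∧_; _∨_; not; if_then_else_)
open import Data.Fin using (Fin; toℕ; remQuot; _≟_)
open import Data.List using (List; []; _∷_; allFin; filter; length; foldr; map)
open import Data.Nat.ListAction using (sum)
open import Data.Product using (_×_; _,_; proj₁; proj₂; ∃; Σ)
open import Relation.Binary.PropositionalEquality using (_≡_; _≢_)
open import Relation.Nullary.Decidable using (⌊_⌋)

record Graph : Set where
  field
    v   : ℕ
    adj : Fin v → Fin v → Bool
open Graph public

IsSimple : Graph → Set
IsSimple G = (∀ a b → adj G a b ≡ adj G b a) × (∀ a → adj G a a ≡ false)

-- Disjoint union of k copies of G: vertex i ∈ Fin (k * v) ↔ (copy, vertex) via remQuot.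
copies : ℕ → Graph → Graph
copies k G = record
  { v   = k * v G
  ; adj = λ i j → let (c , a) = remQuot {k} (v G) i
                      (d , b) = remQuot {k} (v G) j
                  in ⌊ c ≟ d ⌋ ∧ adj G a b }

IsHom : (G : Graph) (n : ℕ) → (Fin (v G) → Fin n) → Set
IsHom G n f = ∀ a b → adj G a b ≡ true → f a ≢ f b

count : ∀ {m} → (Fin m → Bool) → ℕ
count {m} p = length (filter (λ i → p i Data.Bool.≟ true) (allFin m))
  where import Data.Bool

any : ∀ {m} → (Fin m → Bool) → Bool
any {m} p = foldr (λ i b → p i ∨ b) false (allFin m)

_==_ : ∀ {n} → Fin n → Fin n → Bool
x == y = ⌊ x ≟ y ⌋

samePair : ∀ {n} → Fin n → Fin n → Fin n → Fin n → Bool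
samePair p q x y = (p == x ∧ q == y) ∨ (p == y ∧ q == x)

-- number of edges ab (each unordered edge counted once, via toℕ a < toℕ b)
-- of G with {f a, f b} = {x, y}
edgeMult : (G : Graph) {n : ℕ} → (Fin (v G) → Fin n) → Fin n → Fin n → ℕ
edgeMult G f x y =
  sum (map (λ a → count (λ b → (toℕ a <ᵇ toℕ b) ∧ adj G a b ∧ samePair (f a) (f b) x y))
           (allFin (v G)))

isOdd : ℕ → Bool
isOdd zero = false
isOdd (suc m) = not (isOdd m)

oddEdge : (G : Graph) {n : ℕ} → (Fin (v G) → Fin n) → Fin n → Fin n → Bool
oddEdge G f x y = not (x == y) ∧ isOdd (edgeMult G f x y)

oddVertex : (G : Graph) {n : ℕ} → (Fin (v G) → Fin n) → Fin n → Bool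
oddVertex G f x = any (λ y → oddEdge G f x y)

numOdd : (G : Graph) {n : ℕ} → (Fin (v G) → Fin n) → ℕ
numOdd G f = count (oddVertex G f)

imageSize : (G : Graph) {n : ℕ} → (Fin (v G) → Fin n) → ℕ
imageSize G {n} f = count {n} (λ x → any (λ a → f a == x))

-- 2·r(f) = 2|V(G)| - 2|f(V(G))| + |V_odd(f)|  (doubled to stay in ℕ; |f(V)| ≤ |V|)
twiceR : (G : Graph) {n : ℕ} → (Fin (v G) → Fin n) → ℕ
twiceR G f = 2 * v G Data.Nat.∸ 2 * imageSize G f + numOdd G f

IsTwiceRbar : (G : Graph) (n : ℕ) → ℕ → Set
IsTwiceRbar G n m =
  Σ (Fin (v G) → Fin n) (λ f → IsHom G n f × twiceR G f ≡ m)
  × (∀ (f : Fin (v G) → Fin n) → IsHom G n f → m ≤ twiceR G f)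

-- Everything rests on a local
-- count at each vertex x of K_n.  If the vertex set of K splits into blocks
-- G and H with no edges between them, and F : K → K_n restricts to f on G and
-- to g on H, then the multiplicity of a pair {x,y} under F is the sum of its
-- multiplicities under f and g, so oddness of edges is additive mod 2.  From
-- this, vertex by vertex, 2r(f) + 2r(g) ≤ 2r(F), with equality when the images
-- of f and g are disjoint (Decomposition).  By induction on k, every
-- homomorphism G^k → K_n has 2r ≥ k·2r̄(G) (the lower bound).
-- For the upper bound, 2r(f) depends only on the kernel of f (which vertices
-- are identified), proved by counting image points through their first
-- preimages.  Given an optimal f, we place k relabelled copies of f on
-- pairwise disjoint parts of K_n (possible since n ≥ k|V(G)|); each copy has
-- the kernel of f and additivity gives exactly k·2r̄(G).
module Submission where

open import Defs
open import Data.Nat using (ℕ; zero; suc; _+_; _*_; _∸_; _<ᵇ_; _≤_; z≤n; s≤s)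
open import Data.Nat.Properties hiding (_≟_)
open import Data.Nat.Tactic.RingSolver using (solve-∀)
import Data.Nat.ListAction as List
open import Data.Bool using (Bool; true; false; _∧_; _∨_; not; _xor_; if_then_else_)
open import Data.Bool using () renaming (_≟_ to _≟ᵇ_)
import Data.Bool.Properties as Boolₚ
open import Data.Fin using (Fin; zero; suc; toℕ; _↑ˡ_; _↑ʳ_; remQuot; combine; inject≤; _≟_)
import Data.Fin.Properties as Finₚ
open import Data.List using (filter; length; foldr; map; tabulate)
open import Data.Product using (_×_; _,_; proj₁; proj₂; ∃)
open import Data.Empty using (⊥-elim)
open import Function using (_∘_; id)
open import Relation.Binary.PropositionalEquality
open import Relation.Nullary using (yes; no; contradiction)
open import Algebra.Properties.CommutativeMonoid.Sum +-0-commutativeMonoid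
  using (sum; sum-cong-≗; ∑-distrib-+)
open import Algebra.Properties.Semiring.Sum +-*-semiring using (*-distribˡ-sum)

⟦_⟧ : Bool → ℕ
⟦ true ⟧  = 1
⟦ false ⟧ = 0

⟦⟧≤1 : ∀ b → ⟦ b ⟧ ≤ 1
⟦⟧≤1 true  = s≤s z≤n
⟦⟧≤1 false = z≤n

⟦∨⟧≤ : ∀ a b → ⟦ a ∨ b ⟧ ≤ ⟦ a ⟧ + ⟦ b ⟧
⟦∨⟧≤ true  b = s≤s z≤n
⟦∨⟧≤ false b = ≤-refl

⟦⟧-split : ∀ b c → ⟦ b ⟧ ≡ ⟦ b ∧ c ⟧ + ⟦ b ∧ not c ⟧
⟦⟧-split false c     = refl
⟦⟧-split true  true  = refl
⟦⟧-split true  false = refl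

# : ∀ {m} → (Fin m → Bool) → ℕ
# p = sum (λ i → ⟦ p i ⟧)

some : ∀ {m} → (Fin m → Bool) → Bool
some {zero}  p = false
some {suc m} p = p zero ∨ some (p ∘ suc)

count-tabulate : ∀ {A : Set} {m} (p : A → Bool) (g : Fin m → A) →
  length (filter (λ x → p x ≟ᵇ true) (tabulate g)) ≡ # (p ∘ g)
count-tabulate {m = zero}  p g = refl
count-tabulate {m = suc m} p g with p (g zero)
... | true  = cong suc (count-tabulate p (g ∘ suc))
... | false = count-tabulate p (g ∘ suc)

any-tabulate : ∀ {A : Set} {m} (p : A → Bool) (g : Fin m → A) →
  foldr (λ i b → p i ∨ b) false (tabulate g) ≡ some (p ∘ g)
any-tabulate {m = zero}  p g = refl
any-tabulate {m = suc m} p g = cong (p (g zero) ∨_) (any-tabulate p (g ∘ suc))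

sum-tabulate : ∀ {A : Set} {m} (h : A → ℕ) (g : Fin m → A) →
  List.sum (map h (tabulate g)) ≡ sum (h ∘ g)
sum-tabulate {m = zero}  h g = refl
sum-tabulate {m = suc m} h g = cong (h (g zero) +_) (sum-tabulate h (g ∘ suc))

#-cong : ∀ {m} {p q : Fin m → Bool} → (∀ i → p i ≡ q i) → # p ≡ # q
#-cong e = sum-cong-≗ (cong ⟦_⟧ ∘ e)

some-cong : ∀ {m} {p q : Fin m → Bool} → (∀ i → p i ≡ q i) → some p ≡ some q
some-cong {zero}  e = refl
some-cong {suc m} e = cong₂ _∨_ (e zero) (some-cong (e ∘ suc))

∑-mono : ∀ {m} {h k : Fin m → ℕ} → (∀ i → h i ≤ k i) → sum h ≤ sum k
∑-mono {zero}  e = z≤n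
∑-mono {suc m} e = +-mono-≤ (e zero) (∑-mono (e ∘ suc))

∑-split : ∀ p {q} (h : Fin (p + q) → ℕ) →
  sum h ≡ sum (λ a → h (a ↑ˡ q)) + sum (λ b → h (p ↑ʳ b))
∑-split zero    h = refl
∑-split (suc p) h =
  trans (cong (h zero +_) (∑-split p (h ∘ suc))) (sym (+-assoc (h zero) _ _))

some-split : ∀ p {q} (h : Fin (p + q) → Bool) →
  some h ≡ some (λ a → h (a ↑ˡ q)) ∨ some (λ b → h (p ↑ʳ b))
some-split zero    h = refl
some-split (suc p) h =
  trans (cong (h zero ∨_) (some-split p (h ∘ suc))) (sym (Boolₚ.∨-assoc (h zero) _ _))

∑-+₃ : ∀ {m} (a b c : Fin m → ℕ) →
  sum (λ x → a x + b x + c x) ≡ sum a + sum b + sum c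
∑-+₃ a b c = trans (∑-distrib-+ (λ x → a x + b x) c) (cong (_+ sum c) (∑-distrib-+ a b))

∑-double : ∀ {m} (a : Fin m → ℕ) → sum (λ x → 2 * a x) ≡ 2 * sum a
∑-double a = sym (*-distribˡ-sum 2 a)

∑-zero : ∀ {m} {h : Fin m → ℕ} → (∀ i → h i ≡ 0) → sum h ≡ 0
∑-zero {zero}  e = refl
∑-zero {suc m} e rewrite e zero = ∑-zero (e ∘ suc)

#-none : ∀ {m} {p : Fin m → Bool} → (∀ i → p i ≡ false) → # p ≡ 0
#-none e = ∑-zero (cong ⟦_⟧ ∘ e)

some-none : ∀ {m} {p : Fin m → Bool} → (∀ i → p i ≡ false) → some p ≡ false
some-none {zero}  e = refl
some-none {suc m} e rewrite e zero = some-none (e ∘ suc)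

some-intro : ∀ {m} (p : Fin m → Bool) i → p i ≡ true → some p ≡ true
some-intro p zero    e rewrite e = refl
some-intro p (suc i) e rewrite some-intro (p ∘ suc) i e = Boolₚ.∨-zeroʳ (p zero)

some-witness : ∀ {m} (p : Fin m → Bool) → some p ≡ true → ∃ λ i → p i ≡ true
some-witness {suc m} p e with p zero in p0
... | true  = zero , p0
... | false = let (i , pi) = some-witness (p ∘ suc) e in suc i , pi

some-false : ∀ {m} (p : Fin m → Bool) → some p ≡ false → ∀ i → p i ≡ false
some-false p e i with p i in pi
... | false = refl
... | true  = trans (sym (some-intro p i pi)) e

bool-ext : ∀ {a b : Bool} → (a ≡ true → b ≡ true) → (b ≡ true → a ≡ true) → a ≡ b
bool-ext {true}  {b}     ab ba = sym (ab refl)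
bool-ext {false} {true}  ab ba = ba refl
bool-ext {false} {false} ab ba = refl

bool-contra : ∀ {a b : Bool} → (a ≡ false → b ≡ false) → b ≡ true → a ≡ true
bool-contra {true}  h e = refl
bool-contra {false} h e = trans (sym (h refl)) e

==-refl : ∀ {n} (x : Fin n) → (x == x) ≡ true
==-refl x with x ≟ x
... | yes _  = refl
... | no x≢x = ⊥-elim (x≢x refl)

==-≢ : ∀ {n} {x y : Fin n} → x ≢ y → (x == y) ≡ false
==-≢ {x = x} {y} x≢y with x ≟ y
... | yes x≡y = ⊥-elim (x≢y x≡y)
... | no _    = refl

==-true : ∀ {n} {x y : Fin n} → (x == y) ≡ true → x ≡ y
==-true {x = x} {y} e with x ≟ y
... | yes x≡y = x≡y

==-sym : ∀ {n} (x y : Fin n) → (x == y) ≡ (y == x)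
==-sym x y with x ≟ y
... | yes refl = sym (==-refl x)
... | no x≢y   = sym (==-≢ (x≢y ∘ sym))

==-injective : ∀ {n n'} (σ : Fin n → Fin n') → (∀ x y → σ x ≡ σ y → x ≡ y) →
  ∀ x y → (σ x == σ y) ≡ (x == y)
==-injective σ inj x y with x ≟ y
... | yes refl = ==-refl (σ x)
... | no x≢y   = ==-≢ (x≢y ∘ inj x y)

#-at : ∀ {n} (p : Fin n → Bool) x₀ → # (λ x → p x ∧ (x == x₀)) ≡ ⟦ p x₀ ⟧
#-at {suc n} p zero =
  trans (cong₂ _+_ (cong ⟦_⟧ (trans (cong (p zero ∧_) (==-refl (zero {n})))
                                    (Boolₚ.∧-identityʳ (p zero))))
                   (#-none (λ x → trans (cong (p (suc x) ∧_) (==-≢ {x = suc x} {zero} λ ()))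
                                        (Boolₚ.∧-zeroʳ (p (suc x))))))
        (+-identityʳ _)
#-at p (suc y) =
  cong₂ _+_ (cong ⟦_⟧ (trans (cong (p zero ∧_) (==-≢ {x = zero} {suc y} λ ())) (Boolₚ.∧-zeroʳ (p zero))))
            (trans (#-cong (λ x → cong (p (suc x) ∧_)
                                       (==-injective suc (λ _ _ → Finₚ.suc-injective) x y)))
                   (#-at (p ∘ suc) y))

#-remove : ∀ {n} (p : Fin n → Bool) x₀ →
  # p ≡ ⟦ p x₀ ⟧ + # (λ x → p x ∧ not (x == x₀))
#-remove p x₀ =
  trans (sum-cong-≗ (λ x → ⟦⟧-split (p x) (x == x₀)))
  (trans (∑-distrib-+ (λ x → ⟦ p x ∧ (x == x₀) ⟧) (λ x → ⟦ p x ∧ not (x == x₀) ⟧))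
         (cong (_+ # (λ x → p x ∧ not (x == x₀))) (#-at p x₀)))

module _ {n : ℕ} where

  inImage : ∀ {m} → (Fin m → Fin n) → Fin n → Bool
  inImage f x = some (λ a → f a == x)

  edgeOnto : (G : Graph) → (Fin (v G) → Fin n) → Fin n → Fin n → Fin (v G) → Fin (v G) → Bool
  edgeOnto G f x y a b = (toℕ a <ᵇ toℕ b) ∧ adj G a b ∧ samePair (f a) (f b) x y

  mult : (G : Graph) → (Fin (v G) → Fin n) → Fin n → Fin n → ℕ
  mult G f x y = sum (λ a → # (edgeOnto G f x y a))

  oddPair : (G : Graph) → (Fin (v G) → Fin n) → Fin n → Fin n → Bool
  oddPair G f x y = not (x == y) ∧ isOdd (mult G f x y)

  oddAt : (G : Graph) → (Fin (v G) → Fin n) → Fin n → Bool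
  oddAt G f x = some (oddPair G f x)

twiceR-unfold : (G : Graph) {n : ℕ} (f : Fin (v G) → Fin n) →
  twiceR G f ≡ 2 * v G ∸ 2 * # (inImage f) + # (oddAt G f)
twiceR-unfold G f = cong₂ (λ i o → 2 * v G ∸ 2 * i + o)
  (trans (count-tabulate (λ x → any (λ a → f a == x)) id)
         (#-cong (λ x → any-tabulate (λ a → f a == x) id)))
  (trans (count-tabulate (oddVertex G f) id)
         (#-cong (λ x → trans (any-tabulate (oddEdge G f x) id)
                              (some-cong (λ y → cong (λ e → not (x == y) ∧ isOdd e)
                                                      (mult-unfold x y))))))
  where
  mult-unfold : ∀ x y → edgeMult G f x y ≡ mult G f x y
  mult-unfold x y =
    trans (sum-tabulate (λ a → count (edgeOnto G f x y a)) id)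
          (sum-cong-≗ (λ a → count-tabulate (edgeOnto G f x y a) id))

samePair-swap : ∀ {n} (p q x y : Fin n) → samePair p q x y ≡ samePair p q y x
samePair-swap p q x y = Boolₚ.∨-comm (p == x ∧ q == y) (p == y ∧ q == x)

samePair-outside : ∀ {n} (p q x y : Fin n) → (p == x) ≡ false → (q == x) ≡ false →
  samePair p q x y ≡ false
samePair-outside p q x y px qx rewrite px | qx = Boolₚ.∧-zeroʳ (p == y)

mult-swap : (G : Graph) {n : ℕ} (f : Fin (v G) → Fin n) (x y : Fin n) → mult G f x y ≡ mult G f y x
mult-swap G f x y = sum-cong-≗ λ a → #-cong λ b →
  cong (λ s → (toℕ a <ᵇ toℕ b) ∧ adj G a b ∧ s) (samePair-swap (f a) (f b) x y)

mult-outside : (G : Graph) {n : ℕ} (f : Fin (v G) → Fin n) (x y : Fin n) →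
  inImage f x ≡ false → mult G f x y ≡ 0
mult-outside G f x y x∉ = ∑-zero λ a → #-none λ b →
  trans (cong (λ s → (toℕ a <ᵇ toℕ b) ∧ adj G a b ∧ s)
              (samePair-outside (f a) (f b) x y (missed a) (missed b)))
        (trans (cong ((toℕ a <ᵇ toℕ b) ∧_) (Boolₚ.∧-zeroʳ (adj G a b))) (Boolₚ.∧-zeroʳ _))
  where
  missed : ∀ c → (f c == x) ≡ false
  missed = some-false (λ c → f c == x) x∉

oddPair-outsideˡ : (G : Graph) {n : ℕ} (f : Fin (v G) → Fin n) (x y : Fin n) →
  inImage f x ≡ false → oddPair G f x y ≡ false
oddPair-outsideˡ G f x y x∉ rewrite mult-outside G f x y x∉ = Boolₚ.∧-zeroʳ _

oddPair-outsideʳ : (G : Graph) {n : ℕ} (f : Fin (v G) → Fin n) (x y : Fin n) →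
  inImage f y ≡ false → oddPair G f x y ≡ false
oddPair-outsideʳ G f x y y∉ rewrite mult-swap G f x y | mult-outside G f y x y∉ =
  Boolₚ.∧-zeroʳ _

oddAt-outside : (G : Graph) {n : ℕ} (f : Fin (v G) → Fin n) (x : Fin n) →
  inImage f x ≡ false → oddAt G f x ≡ false
oddAt-outside G f x x∉ = some-none (λ y → oddPair-outsideˡ G f x y x∉)

image-bound : ∀ {m n} (f : Fin m → Fin n) → # (inImage f) ≤ m
image-bound {zero}  f = ≤-reflexive (#-none {p = inImage f} (λ _ → refl))
image-bound {suc m} f = begin
  # (inImage f)                                      ≤⟨ ∑-mono (λ x → ⟦∨⟧≤ (f zero == x) _) ⟩
  sum (λ x → ⟦ f zero == x ⟧ + ⟦ inImage (f ∘ suc) x ⟧) ≡⟨ ∑-distrib-+ (λ x → ⟦ f zero == x ⟧) (λ x → ⟦ inImage (f ∘ suc) x ⟧) ⟩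
  # (λ x → f zero == x) + # (inImage (f ∘ suc))        ≤⟨ +-mono-≤ (≤-reflexive single) (image-bound (f ∘ suc)) ⟩
  suc m                                              ∎
  where
  open ≤-Reasoning
  single : # (λ x → f zero == x) ≡ 1
  single = trans (#-cong (λ x → ==-sym (f zero) x)) (#-at (λ _ → true) (f zero))

-- The balance 2·r(f) + 2|im f| = 2|V| + |V_odd(f)|, free of truncated subtraction.
twiceR-balance : (G : Graph) {n : ℕ} (f : Fin (v G) → Fin n) →
  twiceR G f + 2 * # (inImage f) ≡ 2 * v G + # (oddAt G f)
twiceR-balance G f rewrite twiceR-unfold G f = begin
  d + o + 2 * i   ≡⟨ +-assoc d o (2 * i) ⟩
  d + (o + 2 * i) ≡⟨ cong (d +_) (+-comm o (2 * i)) ⟩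
  d + (2 * i + o) ≡⟨ sym (+-assoc d (2 * i) o) ⟩
  d + 2 * i + o   ≡⟨ cong (_+ o) (m∸n+n≡m (*-monoʳ-≤ 2 (image-bound f))) ⟩
  2 * v G + o     ∎
  where
  open ≡-Reasoning
  i o d : ℕ
  i = # (inImage f)
  o = # (oddAt G f)
  d = 2 * v G ∸ 2 * i

twiceR-empty : (a : Fin 0 → Fin 0 → Bool) {n : ℕ} (f : Fin 0 → Fin n) →
  twiceR (record { v = 0 ; adj = a }) f ≡ 0
twiceR-empty a {n} f = begin
  twiceR G₀ f                                       ≡⟨ twiceR-unfold G₀ f ⟩
  0 ∸ 2 * # (inImage f) + # (oddAt G₀ f)              ≡⟨ cong₂ _+_ (0∸n≡0 (2 * # (inImage f))) no-odd ⟩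
  0                                                 ∎
  where
  open ≡-Reasoning
  G₀ : Graph
  G₀ = record { v = 0 ; adj = a }
  no-odd : # (oddAt G₀ f) ≡ 0
  no-odd = #-none (λ x → oddAt-outside G₀ f x refl)

isOdd-+ : ∀ a b → isOdd (a + b) ≡ isOdd a xor isOdd b
isOdd-+ zero    b = refl
isOdd-+ (suc a) b rewrite isOdd-+ a b with isOdd a
... | true  = Boolₚ.not-involutive (isOdd b)
... | false = refl

-- Disjoint unions

-- Comparing two quantities through balance equations: if t_G, t_H, t_K satisfy
-- t + i = V + o for their respective i, o, then t_G + t_H versus t_K is decided
-- by o_G + o_H + i_K versus o_K + i_G + i_H.
module BalanceComparison
  {tG tH tK iG iH iK oG oH oK V W : ℕ}
  (balG : tG + iG ≡ V + oG) (balH : tH + iH ≡ W + oH) (balK : tK + iK ≡ (V + W) + oK)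
  where

  private
    c : ℕ
    c = iG + iH + iK

    sumGH : (tG + tH) + c ≡ (V + W) + (oG + oH + iK)
    sumGH = begin
      (tG + tH) + (iG + iH + iK) ≡⟨ shuffle₁ tG tH iG iH iK ⟩
      (tG + iG) + (tH + iH) + iK ≡⟨ cong₂ (λ p q → p + q + iK) balG balH ⟩
      (V + oG) + (W + oH) + iK   ≡⟨ shuffle₂ V W oG oH iK ⟩
      (V + W) + (oG + oH + iK)   ∎
      where
      open ≡-Reasoning
      shuffle₁ : ∀ a b c d e → (a + b) + (c + d + e) ≡ (a + c) + (b + d) + e
      shuffle₁ = solve-∀
      shuffle₂ : ∀ a b c d e → (a + c) + (b + d) + e ≡ (a + b) + (c + d + e)
      shuffle₂ = solve-∀

    sumK : tK + c ≡ (V + W) + (oK + iG + iH)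
    sumK = begin
      tK + (iG + iH + iK)        ≡⟨ shuffle₃ tK iG iH iK ⟩
      (tK + iK) + (iG + iH)      ≡⟨ cong (_+ (iG + iH)) balK ⟩
      (V + W) + oK + (iG + iH)   ≡⟨ shuffle₄ (V + W) oK iG iH ⟩
      (V + W) + (oK + iG + iH)   ∎
      where
      open ≡-Reasoning
      shuffle₃ : ∀ a b d e → a + (b + d + e) ≡ (a + e) + (b + d)
      shuffle₃ = solve-∀
      shuffle₄ : ∀ a b d e → a + b + (d + e) ≡ a + (b + d + e)
      shuffle₄ = solve-∀

  compare≤ : oG + oH + iK ≤ oK + iG + iH → tG + tH ≤ tK
  compare≤ le = +-cancelʳ-≤ c (tG + tH) tK
    (subst₂ _≤_ (sym sumGH) (sym sumK) (+-monoʳ-≤ (V + W) le))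

  compare≡ : oG + oH + iK ≡ oK + iG + iH → tG + tH ≡ tK
  compare≡ eq = +-cancelʳ-≡ c (tG + tH) tK
    (trans sumGH (trans (cong ((V + W) +_) eq) (sym sumK)))

-- A graph K on Fin (|G| + |H|) whose adjacency is block diagonal with blocks G
-- and H, i.e. the disjoint union of G and H, and a map F : K → K_n with
-- restrictions `left` to G and `right` to H.
module Decomposition (G H : Graph) (A : Fin (v G + v H) → Fin (v G + v H) → Bool)
  (adj-ll : ∀ a b → A (a ↑ˡ v H) (b ↑ˡ v H) ≡ adj G a b)
  (adj-rr : ∀ a b → A (v G ↑ʳ a) (v G ↑ʳ b) ≡ adj H a b)
  (adj-lr : ∀ a b → A (a ↑ˡ v H) (v G ↑ʳ b) ≡ false)
  (adj-rl : ∀ a b → A (v G ↑ʳ a) (b ↑ˡ v H) ≡ false)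
  {n : ℕ} (F : Fin (v G + v H) → Fin n) where

  K : Graph
  K = record { v = v G + v H ; adj = A }

  left : Fin (v G) → Fin n
  left a = F (a ↑ˡ v H)

  right : Fin (v H) → Fin n
  right b = F (v G ↑ʳ b)

  -- The edges of K onto {x, y} are those of G and of H, shifted into their
  -- blocks; the order a < b is preserved by the shift.
  private
    <ᵇ-shift : ∀ p a b → ((p + a) <ᵇ (p + b)) ≡ (a <ᵇ b)
    <ᵇ-shift zero    a b = refl
    <ᵇ-shift (suc p) a b = <ᵇ-shift p a b

    edge-ll : ∀ x y a b → edgeOnto K F x y (a ↑ˡ v H) (b ↑ˡ v H) ≡ edgeOnto G left x y a b
    edge-ll x y a b rewrite Finₚ.toℕ-↑ˡ a (v H) | Finₚ.toℕ-↑ˡ b (v H) | adj-ll a b = refl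

    edge-rr : ∀ x y a b → edgeOnto K F x y (v G ↑ʳ a) (v G ↑ʳ b) ≡ edgeOnto H right x y a b
    edge-rr x y a b rewrite Finₚ.toℕ-↑ʳ (v G) a | Finₚ.toℕ-↑ʳ (v G) b | adj-rr a b
                          | <ᵇ-shift (v G) (toℕ a) (toℕ b) = refl

    edge-lr : ∀ x y a b → edgeOnto K F x y (a ↑ˡ v H) (v G ↑ʳ b) ≡ false
    edge-lr x y a b rewrite adj-lr a b = Boolₚ.∧-zeroʳ _

    edge-rl : ∀ x y a b → edgeOnto K F x y (v G ↑ʳ a) (b ↑ˡ v H) ≡ false
    edge-rl x y a b rewrite adj-rl a b = Boolₚ.∧-zeroʳ _

  mult-split : ∀ x y → mult K F x y ≡ mult G left x y + mult H right x y
  mult-split x y = trans (∑-split (v G) (λ a → # (edgeOnto K F x y a)))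
                         (cong₂ _+_ (sum-cong-≗ row-left) (sum-cong-≗ row-right))
    where
    row-left : ∀ a → # (edgeOnto K F x y (a ↑ˡ v H)) ≡ # (edgeOnto G left x y a)
    row-left a = trans (∑-split (v G) _)
      (trans (cong₂ _+_ (#-cong (edge-ll x y a)) (#-none (edge-lr x y a))) (+-identityʳ _))
    row-right : ∀ a → # (edgeOnto K F x y (v G ↑ʳ a)) ≡ # (edgeOnto H right x y a)
    row-right a = trans (∑-split (v G) _)
      (cong₂ _+_ (#-none (edge-rl x y a)) (#-cong (edge-rr x y a)))

  inImage-split : ∀ x → inImage F x ≡ inImage left x ∨ inImage right x
  inImage-split x = some-split (v G) (λ a → F a == x)

  oddPair-split : ∀ x y → oddPair K F x y ≡ oddPair G left x y xor oddPair H right x y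
  oddPair-split x y rewrite mult-split x y | isOdd-+ (mult G left x y) (mult H right x y) =
    ∧-distrib-xor (not (x == y)) (isOdd (mult G left x y)) (isOdd (mult H right x y))
    where
    ∧-distrib-xor : ∀ c p q → c ∧ (p xor q) ≡ (c ∧ p) xor (c ∧ q)
    ∧-distrib-xor true  p q = refl
    ∧-distrib-xor false p q = refl

  oddAt-left : ∀ x → inImage right x ≡ false → oddAt K F x ≡ oddAt G left x
  oddAt-left x x∉ = some-cong λ y → trans (oddPair-split x y)
    (trans (cong (oddPair G left x y xor_) (oddPair-outsideˡ H right x y x∉))
           (Boolₚ.xor-identityʳ _))

  oddAt-right : ∀ x → inImage left x ≡ false → oddAt K F x ≡ oddAt H right x
  oddAt-right x x∉ = some-cong λ y → trans (oddPair-split x y)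
    (cong (_xor oddPair H right x y) (oddPair-outsideˡ G left x y x∉))

  -- The local count at a vertex x of K_n: the contribution of x to
  -- |V_odd(left)| + |V_odd(right)| + 2|im F| versus |V_odd(F)| + 2|im left| + 2|im right|.
  localGH localK : Fin n → ℕ
  localGH x = ⟦ oddAt G left x ⟧ + ⟦ oddAt H right x ⟧ + 2 * ⟦ inImage F x ⟧
  localK  x = ⟦ oddAt K F x ⟧ + 2 * ⟦ inImage left x ⟧ + 2 * ⟦ inImage right x ⟧

  local≡ : ∀ x → (inImage left x ≡ true → inImage right x ≡ false) → localGH x ≡ localK x
  local≡ x apart rewrite inImage-split x with inImage left x in inL | inImage right x in inR
  ... | true  | true  with () ← apart refl
  ... | true  | false rewrite oddAt-left x inR | oddAt-outside H right x inR =
    trans (cong (_+ 2) (+-identityʳ _)) (sym (+-identityʳ _))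
  ... | false | true  rewrite oddAt-right x inL | oddAt-outside G left x inL =
    cong (_+ 2) (sym (+-identityʳ _))
  ... | false | false rewrite oddAt-left x inR | oddAt-outside G left x inL
                            | oddAt-outside H right x inR = refl

  -- At a shared image vertex the left side is at most 4 while the right is at least 4.
  local≤ : ∀ x → localGH x ≤ localK x
  local≤ x = by-cases (inImage left x) (inImage right x) refl refl
    where
    by-cases : ∀ l r → inImage left x ≡ l → inImage right x ≡ r → localGH x ≤ localK x
    by-cases false r     inL inR = ≤-reflexive (local≡ x (λ e → contradiction (trans (sym inL) e) λ ()))
    by-cases true  false inL inR = ≤-reflexive (local≡ x (λ _ → inR))
    by-cases true  true  inL inR rewrite inImage-split x | inL | inR = begin
      ⟦ oddAt G left x ⟧ + ⟦ oddAt H right x ⟧ + 2 ≤⟨ +-monoˡ-≤ 2 (+-mono-≤ (⟦⟧≤1 (oddAt G left x)) (⟦⟧≤1 (oddAt H right x))) ⟩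
      4                                            ≤⟨ m≤n+m 4 ⟦ oddAt K F x ⟧ ⟩
      ⟦ oddAt K F x ⟧ + 4                          ≡⟨ sym (+-assoc ⟦ oddAt K F x ⟧ 2 2) ⟩
      ⟦ oddAt K F x ⟧ + 2 + 2                      ∎
      where open ≤-Reasoning

  private
    sumGH : sum localGH ≡ # (oddAt G left) + # (oddAt H right) + 2 * # (inImage F)
    sumGH = trans (∑-+₃ (λ x → ⟦ oddAt G left x ⟧) (λ x → ⟦ oddAt H right x ⟧)
                        (λ x → 2 * ⟦ inImage F x ⟧))
                  (cong (# (oddAt G left) + # (oddAt H right) +_)
                        (∑-double (λ x → ⟦ inImage F x ⟧)))

    sumK : sum localK ≡ # (oddAt K F) + 2 * # (inImage left) + 2 * # (inImage right)
    sumK = trans (∑-+₃ (λ x → ⟦ oddAt K F x ⟧) (λ x → 2 * ⟦ inImage left x ⟧)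
                       (λ x → 2 * ⟦ inImage right x ⟧))
                 (cong₂ (λ p q → # (oddAt K F) + p + q)
                        (∑-double (λ x → ⟦ inImage left x ⟧)) (∑-double (λ x → ⟦ inImage right x ⟧)))

    open BalanceComparison
      {twiceR G left} {twiceR H right} {twiceR K F}
      {2 * # (inImage left)} {2 * # (inImage right)} {2 * # (inImage F)}
      {# (oddAt G left)} {# (oddAt H right)} {# (oddAt K F)} {2 * v G} {2 * v H}
      (twiceR-balance G left) (twiceR-balance H right)
      (trans (twiceR-balance K F) (cong (_+ # (oddAt K F)) (*-distribˡ-+ 2 (v G) (v H))))

  superadditive : twiceR G left + twiceR H right ≤ twiceR K F
  superadditive = compare≤ (subst₂ _≤_ sumGH sumK (∑-mono local≤))

  additive : (∀ x → inImage left x ≡ true → inImage right x ≡ false) →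
    twiceR K F ≡ twiceR G left + twiceR H right
  additive apart = sym (compare≡ (trans (sym sumGH) (trans (sum-cong-≗ (λ x → local≡ x (apart x))) sumK)))

-- The lower bound

module CopiesSplit (G : Graph) (k : ℕ) where

  adj-ll : ∀ a b → adj (copies (suc k) G) (a ↑ˡ k * v G) (b ↑ˡ k * v G) ≡ adj G a b
  adj-ll a b rewrite Finₚ.splitAt-↑ˡ (v G) a (k * v G) | Finₚ.splitAt-↑ˡ (v G) b (k * v G) = refl

  adj-rr : ∀ a b → adj (copies (suc k) G) (v G ↑ʳ a) (v G ↑ʳ b) ≡ adj (copies k G) a b
  adj-rr a b rewrite Finₚ.splitAt-↑ʳ (v G) (k * v G) a | Finₚ.splitAt-↑ʳ (v G) (k * v G) b =
    cong (_∧ adj G (proj₂ (remQuot {k} (v G) a)) (proj₂ (remQuot {k} (v G) b)))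
         (==-injective suc (λ _ _ → Finₚ.suc-injective)
                       (proj₁ (remQuot {k} (v G) a)) (proj₁ (remQuot {k} (v G) b)))

  adj-lr : ∀ a b → adj (copies (suc k) G) (a ↑ˡ k * v G) (v G ↑ʳ b) ≡ false
  adj-lr a b rewrite Finₚ.splitAt-↑ˡ (v G) a (k * v G) | Finₚ.splitAt-↑ʳ (v G) (k * v G) b = refl

  adj-rl : ∀ a b → adj (copies (suc k) G) (v G ↑ʳ a) (b ↑ˡ k * v G) ≡ false
  adj-rl a b rewrite Finₚ.splitAt-↑ʳ (v G) (k * v G) a | Finₚ.splitAt-↑ˡ (v G) b (k * v G) = refl

  open Decomposition G (copies k G) (adj (copies (suc k) G)) adj-ll adj-rr adj-lr adj-rl public

copies-lower-bound : (G : Graph) {n : ℕ} (m : ℕ) →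
  (∀ (f : Fin (v G) → Fin n) → IsHom G n f → m ≤ twiceR G f) →
  ∀ k (F : Fin (k * v G) → Fin n) → IsHom (copies k G) n F → k * m ≤ twiceR (copies k G) F
copies-lower-bound G m bound zero    F hom = z≤n
copies-lower-bound G m bound (suc k) F hom =
  ≤-trans (+-mono-≤ (bound (left F) hom-left) (copies-lower-bound G m bound k (right F) hom-right))
          (superadditive F)
  where
  open CopiesSplit G k
  hom-left : IsHom G _ (left F)
  hom-left a b ab = hom (a ↑ˡ k * v G) (b ↑ˡ k * v G) (trans (adj-ll a b) ab)
  hom-right : IsHom (copies k G) _ (right F)
  hom-right a b ab = hom (v G ↑ʳ a) (v G ↑ʳ b) (trans (adj-rr a b) ab)

-- 2·r(f) depends only on the kernel of f

SameKernel : ∀ {m n n'} → (Fin m → Fin n) → (Fin m → Fin n') → Set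
SameKernel f f' = ∀ u w → (f u == f w) ≡ (f' u == f' w)

isFirst : ∀ {m n} → (Fin m → Fin n) → Fin m → Bool
isFirst f zero    = true
isFirst f (suc a) = not (f zero == f (suc a)) ∧ isFirst (f ∘ suc) a

isFirst-kernel : ∀ {m n n'} (f : Fin m → Fin n) (f' : Fin m → Fin n') →
  SameKernel f f' → ∀ a → isFirst f a ≡ isFirst f' a
isFirst-kernel f f' same zero    = refl
isFirst-kernel f f' same (suc a) =
  cong₂ (λ p q → not p ∧ q) (same zero (suc a))
        (isFirst-kernel (f ∘ suc) (f' ∘ suc) (λ u w → same (suc u) (suc w)) a)

inImage-self : ∀ {m n} (f : Fin m → Fin n) a → inImage f (f a) ≡ true
inImage-self f a = some-intro (λ b → f b == f a) a (==-refl (f a))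

count-by-fibres : ∀ {m n} (f : Fin m → Fin n) (p : Fin n → Bool) →
  (∀ x → p x ≡ true → inImage f x ≡ true) → # p ≡ # (λ a → isFirst f a ∧ p (f a))
count-by-fibres {zero} f p supported = #-none nowhere
  where
  nowhere : ∀ x → p x ≡ false
  nowhere x with p x in px
  ... | false = refl
  ... | true with () ← supported x px
count-by-fibres {suc m} f p supported = begin
  # p                                                        ≡⟨ #-remove p (f zero) ⟩
  ⟦ p (f zero) ⟧ + # (λ x → p x ∧ not (x == f zero))
    ≡⟨ cong (⟦ p (f zero) ⟧ +_) (count-by-fibres (f ∘ suc) _ supported-rest) ⟩
  ⟦ p (f zero) ⟧ + # (λ a → isFirst (f ∘ suc) a ∧ (p (f (suc a)) ∧ not (f (suc a) == f zero)))
    ≡⟨ cong (⟦ p (f zero) ⟧ +_) (#-cong λ a →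
         trans (cong (λ e → isFirst (f ∘ suc) a ∧ (p (f (suc a)) ∧ not e)) (==-sym (f (suc a)) (f zero)))
               (∧-shuffle (isFirst (f ∘ suc) a) (p (f (suc a))) (f zero == f (suc a)))) ⟩
  ⟦ p (f zero) ⟧ + # (λ a → (not (f zero == f (suc a)) ∧ isFirst (f ∘ suc) a) ∧ p (f (suc a))) ∎
  where
  open ≡-Reasoning
  ∧-shuffle : ∀ i q e → i ∧ (q ∧ not e) ≡ (not e ∧ i) ∧ q
  ∧-shuffle i q true  = trans (cong (i ∧_) (Boolₚ.∧-zeroʳ q)) (Boolₚ.∧-zeroʳ i)
  ∧-shuffle i q false = cong (i ∧_) (Boolₚ.∧-identityʳ q)
  supported-rest : ∀ x → p x ∧ not (x == f zero) ≡ true → inImage (f ∘ suc) x ≡ true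
  supported-rest x px with p x in p-x | x == f zero in x-f0
  ... | true | false =
    trans (cong (_∨ inImage (f ∘ suc) x) (sym (trans (==-sym (f zero) x) x-f0))) (supported x p-x)

some-along : ∀ {m n} (f : Fin m → Fin n) (q : Fin n → Bool) →
  (∀ y → q y ≡ true → inImage f y ≡ true) → some q ≡ some (q ∘ f)
some-along f q supported = bool-ext
  (λ qy → let (y , q-y) = some-witness q qy
              (b , fb)  = some-witness (λ b → f b == y) (supported y q-y)
          in some-intro (q ∘ f) b (trans (cong q (==-true fb)) q-y))
  (λ qfb → let (b , q-fb) = some-witness (q ∘ f) qfb in some-intro q (f b) q-fb)

image-by-fibres : ∀ {m n} (f : Fin m → Fin n) → # (inImage f) ≡ # (isFirst f)
image-by-fibres f = trans (count-by-fibres f (inImage f) (λ _ → id))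
  (#-cong λ a → trans (cong (isFirst f a ∧_) (inImage-self f a)) (Boolₚ.∧-identityʳ _))

module KernelInvariance (G : Graph) {n n' : ℕ} (f : Fin (v G) → Fin n) (f' : Fin (v G) → Fin n')
  (same : SameKernel f f') where

  image-kernel : # (inImage f) ≡ # (inImage f')
  image-kernel = trans (image-by-fibres f)
    (trans (#-cong (isFirst-kernel f f' same)) (sym (image-by-fibres f')))

  -- Between points of the image, everything is determined by equality tests.
  mult-kernel : ∀ c d → mult G f (f c) (f d) ≡ mult G f' (f' c) (f' d)
  mult-kernel c d = sum-cong-≗ λ a → #-cong λ b →
    cong (λ s → (toℕ a <ᵇ toℕ b) ∧ adj G a b ∧ s) (samePair-kernel a b)
    where
    samePair-kernel : ∀ a b → samePair (f a) (f b) (f c) (f d) ≡ samePair (f' a) (f' b) (f' c) (f' d)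
    samePair-kernel a b rewrite same a c | same b d | same a d | same b c = refl

  oddPair-kernel : ∀ c d → oddPair G f (f c) (f d) ≡ oddPair G f' (f' c) (f' d)
  oddPair-kernel c d = cong₂ (λ p q → not p ∧ isOdd q) (same c d) (mult-kernel c d)

  oddAt-along : ∀ {n''} (h : Fin (v G) → Fin n'') a →
    oddAt G h (h a) ≡ some (λ b → oddPair G h (h a) (h b))
  oddAt-along h a = some-along h (oddPair G h (h a))
    (λ y → bool-contra (oddPair-outsideʳ G h (h a) y))

  odd-kernel : # (oddAt G f) ≡ # (oddAt G f')
  odd-kernel = begin
    # (oddAt G f)                             ≡⟨ count-by-fibres f (oddAt G f) odd-in-image ⟩
    # (λ a → isFirst f a ∧ oddAt G f (f a))   ≡⟨ #-cong (λ a → cong₂ _∧_ (isFirst-kernel f f' same a) (oddAt-kernel a)) ⟩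
    # (λ a → isFirst f' a ∧ oddAt G f' (f' a)) ≡⟨ sym (count-by-fibres f' (oddAt G f') odd-in-image) ⟩
    # (oddAt G f')                            ∎
    where
    open ≡-Reasoning
    odd-in-image : ∀ {n''} {h : Fin (v G) → Fin n''} x → oddAt G h x ≡ true → inImage h x ≡ true
    odd-in-image {h = h} x = bool-contra (oddAt-outside G h x)
    oddAt-kernel : ∀ a → oddAt G f (f a) ≡ oddAt G f' (f' a)
    oddAt-kernel a = trans (oddAt-along f a)
      (trans (some-cong (oddPair-kernel a)) (sym (oddAt-along f' a)))

  twiceR-kernel : twiceR G f ≡ twiceR G f'
  twiceR-kernel = trans (twiceR-unfold G f)
    (trans (cong₂ (λ i o → 2 * v G ∸ 2 * i + o) image-kernel odd-kernel) (sym (twiceR-unfold G f')))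

-- The upper bound: k relabelled copies of an optimal homomorphism

==-from-≡ : ∀ {n} {x y : Fin n} → x ≡ y → (x == y) ≡ true
==-from-≡ {x = x} refl = ==-refl x

canon : ∀ {m n} → (Fin m → Fin n) → Fin m → Fin m
canon f zero    = zero
canon f (suc a) = if f zero == f (suc a) then zero else suc (canon (f ∘ suc) a)

canon-fibre : ∀ {m n} (f : Fin m → Fin n) a → f (canon f a) ≡ f a
canon-fibre f zero    = refl
canon-fibre f (suc a) with f zero == f (suc a) in first
... | true  = ==-true first
... | false = canon-fibre (f ∘ suc) a

canon-respects : ∀ {m n} (f : Fin m → Fin n) a b → f a ≡ f b → canon f a ≡ canon f b
canon-respects f zero    zero    fa≡fb = refl
canon-respects f zero    (suc b) fa≡fb rewrite sym fa≡fb | ==-refl (f zero) = refl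
canon-respects f (suc a) zero    fa≡fb rewrite fa≡fb | ==-refl (f zero) = refl
canon-respects f (suc a) (suc b) fa≡fb rewrite fa≡fb with f zero == f (suc b)
... | true  = refl
... | false = cong suc (canon-respects (f ∘ suc) a b fa≡fb)

canon-kernel : ∀ {m n} (f : Fin m → Fin n) → SameKernel (canon f) f
canon-kernel f u w = bool-ext
  (λ same → ==-from-≡ (trans (sym (canon-fibre f u))
                      (trans (cong f (==-true same)) (canon-fibre f w))))
  (λ same → ==-from-≡ (canon-respects f u w (==-true same)))

Injective₂ : ∀ {k m n} → (Fin k → Fin m → Fin n) → Set
Injective₂ e = ∀ c a d b → e c a ≡ e d b → c ≡ d × a ≡ b

module Spread (G : Graph) {n : ℕ} (f : Fin (v G) → Fin n) where

  spread : ∀ k → (Fin k → Fin (v G) → Fin n) → Fin (k * v G) → Fin n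
  spread k e i = e (proj₁ (remQuot {k} (v G) i)) (canon f (proj₂ (remQuot {k} (v G) i)))

  spread-hom : IsHom G n f → ∀ k (e : Fin k → Fin (v G) → Fin n) → Injective₂ e →
    IsHom (copies k G) n (spread k e)
  spread-hom hom k e inj i j =
    separated (proj₁ (remQuot {k} (v G) i)) (proj₁ (remQuot {k} (v G) j))
              (proj₂ (remQuot {k} (v G) i)) (proj₂ (remQuot {k} (v G) j))
    where
    -- Adjacent vertices lie in the same copy, where spread is injective after f.
    separated : ∀ c d a b → (c == d ∧ adj G a b) ≡ true → e c (canon f a) ≢ e d (canon f b)
    separated c d a b adjacent eq with c ≟ d
    ... | yes refl = hom a b adjacent
      (trans (sym (canon-fibre f a))
        (trans (cong f (proj₂ (inj c (canon f a) c (canon f b) eq))) (canon-fibre f b)))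

  spread-twiceR : ∀ k (e : Fin k → Fin (v G) → Fin n) → Injective₂ e →
    twiceR (copies k G) (spread k e) ≡ k * twiceR G f
  spread-twiceR zero    e inj = twiceR-empty (adj (copies zero G)) (spread zero e)
  spread-twiceR (suc k) e inj = begin
    twiceR (copies (suc k) G) F                          ≡⟨ additive F apart ⟩
    twiceR G (left F) + twiceR (copies k G) (right F)     ≡⟨ cong₂ _+_ first-copy other-copies ⟩
    twiceR G f + twiceR (copies k G) (spread k (e ∘ suc)) ≡⟨ cong (twiceR G f +_) (spread-twiceR k (e ∘ suc) inj-rest) ⟩
    twiceR G f + k * twiceR G f                          ∎
    where
    open ≡-Reasoning
    open CopiesSplit G k

    F : Fin (suc k * v G) → Fin n
    F = spread (suc k) e

    left-spread : ∀ a → left F a ≡ e zero (canon f a)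
    left-spread a rewrite Finₚ.splitAt-↑ˡ (v G) a (k * v G) = refl

    right-spread : ∀ b → right F b ≡ spread k (e ∘ suc) b
    right-spread b rewrite Finₚ.splitAt-↑ʳ (v G) (k * v G) b = refl

    inj-rest : Injective₂ (e ∘ suc)
    inj-rest c a d b eq = let (c≡d , a≡b) = inj (suc c) a (suc d) b eq in Finₚ.suc-injective c≡d , a≡b

    -- Copy 0 has the kernel of f, as e zero is injective and canon f has the kernel of f.
    first-copy : twiceR G (left F) ≡ twiceR G f
    first-copy = KernelInvariance.twiceR-kernel G (left F) f λ u w →
      trans (cong₂ _==_ (left-spread u) (left-spread w))
        (trans (==-injective (e zero) (λ a b eq → proj₂ (inj zero a zero b eq)) (canon f u) (canon f w))
               (canon-kernel f u w))

    other-copies : twiceR (copies k G) (right F) ≡ twiceR (copies k G) (spread k (e ∘ suc))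
    other-copies = KernelInvariance.twiceR-kernel (copies k G) (right F) (spread k (e ∘ suc))
      (λ u w → cong₂ _==_ (right-spread u) (right-spread w))

    -- Copy 0 uses the places e zero _, the other copies the places e (suc _) _.
    no-collision : ∀ a b → left F a ≢ right F b
    no-collision a b eq =
      contradiction (proj₁ (inj zero (canon f a) _ _ (trans (sym (left-spread a)) (trans eq (right-spread b)))))
                    λ ()

    apart : ∀ x → inImage (left F) x ≡ true → inImage (right F) x ≡ false
    apart x inL with inImage (right F) x in inR
    ... | false = refl
    ... | true
      with (a , a↦x) ← some-witness (λ a → left F a == x) inL
         | (b , b↦x) ← some-witness (λ b → right F b == x) inR
      = ⊥-elim (no-collision a b (trans (==-true a↦x) (sym (==-true b↦x))))

mainTheorem17 : (G : Graph) → IsSimple G → (k : ℕ) → 1 ≤ k → (n : ℕ) → k * v G ≤ n → (m : ℕ) → IsTwiceRbar G n m → IsTwiceRbar (copies k G) n (k * m)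
mainTheorem17 G _ k _ n k|G|≤n m ((f , hom , twiceR≡m) , optimal) =
  ( spread k place
  , spread-hom hom k place place-injective
  , trans (spread-twiceR k place place-injective) (cong (k *_) twiceR≡m) )
  , copies-lower-bound G m optimal k
  where
  open Spread G f
  -- Copy c occupies the places c·|V(G)|, …, (c+1)·|V(G)| - 1 of K_n.
  place : Fin k → Fin (v G) → Fin n
  place c a = inject≤ (combine c a) k|G|≤n
  place-injective : Injective₂ place
  place-injective c a d b eq =
    Finₚ.combine-injective c a d b (Finₚ.inject≤-injective k|G|≤n k|G|≤n _ _ eq)
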